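{- Let $\mathcal{S}$ be an irreducible nested set in an irreducible built lattice $(\mathcal{L},\mathcal{G})$. Then $$\sum_{G\in\mathcal{S}}\mathrm{rk}([\tau_{\mathcal{S}}(G),G])=\mathrm{rk}(\mathcal{L}).$$
   Context: Geometric lattice: finite lattice with bottom $\hat0$, top $\hat1$, all maximal chains between comparable elements of equal length (rank function $\rho$, $\rho(\hat0)=0$), submodular rank, every element a join of atoms. $\mathrm{rk}([X,Y])=\rho(Y)-\rho(X)$ and $\mathrm{rk}(\mathcal{L})=\rho(\hat1)$. A building set of $\mathcal{L}$ is $\mathcal{G}\subset\mathcal{L}\setminus\{\hat0\}$ such that for every $X$, with $\mathrm{Fact}_{\mathcal{G}}(X)$ the maximal elements of $\mathcal{G}\cap[\hat0,X]$, the join map $\prod_{G\in\mathrm{Fact}_{\mathcal{G}}(X)}[\hat0,G]\to[\hat0,X]$ is a poset isomorphism; $(\mathcal{L},\mathcal{G})$ is a built lattice, irreducible if $\hat1\in\mathcal{G}$. A subset $\mathcal{S}\subset\mathcal{G}$ is nested if no antichain $\mathcal{A}\subset\mathcal{S}$ with $|\mathcal{A}|\ge2$ has $\bigvee\mathcal{A}\in\mathcal{G}$; irreducible if $\hat1\in\mathcal{S}$. For $G\in\mathcal{S}$, $\tau_{\mathcal{S}}(G)=\bigvee\{G'\in\mathcal{S}:G'<G\}$ ($\hat0$ if empty). -}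

module Defs where

open import Data.Nat using (ℕ; zero; suc; _+_; _∸_; _≤_)
open import Data.Fin using (Fin; _≟_)
open import Data.Fin.Subset using (Subset; _∈_; _∉_; _⊆_; ∣_∣)
open import Data.Fin.Subset.Properties using (_∈?_)
open import Data.List using (List; foldr; allFin)
open import Data.List.Relation.Unary.All using (All)
open import Data.Product using (Σ; _×_; _,_)
open import Data.Sum using (_⊎_)
open import Data.Bool using (if_then_else_)
open import Relation.Nullary using (¬_; Dec; does; _×-dec_; ¬?)
open import Relation.Binary.PropositionalEquality using (_≡_; _≢_)
open import Relation.Binary.Definitions using (Decidable)
open import Relation.Binary.Lattice.Structures using (IsLattice)

-- Geometric: graded by a rank function ρ with ρ ⊥ = 0 and ρ increasing by one
-- along every cover relation (equivalently: all maximal chains between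
-- comparable elements have equal length), submodular, atomistic.
record GeomLattice (n : ℕ) : Set₁ where
  infix 4 _≼_
  infixr 6 _∨_
  infixr 7 _∧_
  field
    _≼_  : Fin n → Fin n → Set
    _∨_  : Fin n → Fin n → Fin n
    _∧_  : Fin n → Fin n → Fin n
    isLattice : IsLattice _≡_ _≼_ _∨_ _∧_
    _≼?_ : Decidable _≼_
    ⊥ : Fin n
    ⊤ : Fin n
    ⊥-min : ∀ x → ⊥ ≼ x
    ⊤-max : ∀ x → x ≼ ⊤
    ρ : Fin n → ℕ
    ρ-⊥ : ρ ⊥ ≡ 0
    ρ-cover : ∀ x y → x ≼ y → x ≢ y
              → (∀ z → x ≼ z → z ≼ y → z ≡ x ⊎ z ≡ y)
              → ρ y ≡ suc (ρ x)
    submodular : ∀ x y → ρ (x ∨ y) + ρ (x ∧ y) ≤ ρ x + ρ y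
    atomistic : ∀ x → Σ (List (Fin n)) λ as →
                All (λ a → ⊥ ≼ a × ⊥ ≢ a
                       × (∀ z → ⊥ ≼ z → z ≼ a → z ≡ ⊥ ⊎ z ≡ a)) as
                × foldr _∨_ ⊥ as ≡ x

module _ {n : ℕ} (L : GeomLattice n) where
  open GeomLattice L

  _≺_ : Fin n → Fin n → Set
  x ≺ y = x ≼ y × x ≢ y

  _≺?_ : Decidable _≺_
  x ≺? y = (x ≼? y) ×-dec ¬? (x ≟ y)

  ⋁ : Subset n → Fin n
  ⋁ A = foldr (λ i acc → if does (i ∈? A) then i ∨ acc else acc) ⊥ (allFin n)

  rkInt : Fin n → Fin n → ℕ
  rkInt x y = ρ y ∸ ρ x

  rkL : ℕ
  rkL = ρ ⊤

  Fact : Subset n → Fin n → Fin n → Set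
  Fact G X i = i ∈ G × i ≼ X × (∀ j → j ∈ G → j ≼ X → i ≼ j → i ≡ j)

  IsJoinFam : (Fin n → Set) → (Fin n → Fin n) → Fin n → Set
  IsJoinFam F y z = (∀ i → F i → y i ≼ z)
                  × (∀ w → (∀ i → F i → y i ≼ w) → z ≼ w)

  -- elements of ∏_{G ∈ F} [⊥ , G], represented as families y with y G ≼ G
  InProd : (Fin n → Set) → (Fin n → Fin n) → Set
  InProd F y = ∀ i → F i → y i ≼ i

  -- building set: ⊥ ∉ G and, for every X, the join map
  -- ∏_{G ∈ Fact_G(X)} [⊥,G] → [⊥,X] is a poset isomorphism, i.e. it is
  -- surjective onto [⊥,X] and order-reflecting (monotonicity is automatic,
  -- injectivity follows from reflection + antisymmetry)
  IsBuildingSet : Subset n → Set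
  IsBuildingSet G =
    (∀ i → i ∈ G → i ≢ ⊥)
    × (∀ X →
        (∀ Y → Y ≼ X → Σ (Fin n → Fin n) λ y →
              InProd (Fact G X) y × IsJoinFam (Fact G X) y Y)
      × (∀ y z Y Z → InProd (Fact G X) y → InProd (Fact G X) z
              → IsJoinFam (Fact G X) y Y → IsJoinFam (Fact G X) z Z
              → Y ≼ Z → ∀ i → Fact G X i → y i ≼ z i))

  IsAntichain : Subset n → Set
  IsAntichain A = ∀ i j → i ∈ A → j ∈ A → i ≼ j → i ≡ j

  IsNested : Subset n → Subset n → Set
  IsNested G S = S ⊆ G
    × (∀ A → A ⊆ S → 2 ≤ ∣ A ∣ → IsAntichain A → ⋁ A ∉ G)

  τ : Subset n → Fin n → Fin n
  τ S g = foldr (λ i acc → if does ((i ∈? S) ×-dec (i ≺? g)) then i ∨ acc else acc)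
                ⊥ (allFin n)

  sumOver : Subset n → (Fin n → ℕ) → ℕ
  sumOver S f = foldr (λ i acc → if does (i ∈? S) then f i + acc else acc) 0 (allFin n)

-- The children of H ∈ S, i.e. the maximal elements of S strictly below H, form an
-- antichain whose join is τ_S(H). Because G is building and S is nested, the factors
-- of the join of an antichain A ⊆ S are exactly the members of A, so the join map
-- identifies [⊥ , ⋁ A] with ∏_{a ∈ A} [⊥ , a] and ρ (⋁ A) = Σ_{a ∈ A} ρ a. Hence
-- ρ (τ_S H) is the sum of the ranks of the children of H. Two elements of S above a
-- common element of S are comparable, so every C ∈ S other than ⊤ has exactly one
-- parent and the sum telescopes:
--   Σ_H (ρ H − ρ (τ_S H)) = Σ_H ρ H − Σ_{C ≠ ⊤} ρ C = ρ ⊤.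
module Submission where

open import Level using (Level)
open import Function using (_∘_; id; const; flip; case_of_)
open import Data.Bool using (if_then_else_)
open import Data.Product using (_×_; _,_; proj₁; proj₂; ∃)
open import Data.Sum as Sum using (_⊎_; inj₁; inj₂; [_,_]′)
open import Data.Nat using (ℕ; zero; suc; _+_; _≤_; _<_; z≤n; s≤s)
open import Data.Nat.Properties
  using ( +-identityʳ; +-comm; +-0-commutativeMonoid; ≤-totalOrder; ≤-trans; ≤-reflexive; ≤-antisym
        ; m≤m+n; m∸n+n≡m; <-trans; <⇒≤; ≤⇒≯; +-monoˡ-≤; +-mono-≤; +-cancelˡ-≤; +-cancelʳ-≡
        ; module ≤-Reasoning )
open import Data.Nat.Tactic.RingSolver using (solve-∀)
open import Data.Fin using (Fin; zero; suc; _≟_; punchIn)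
open import Data.Fin.Properties using (punchInᵢ≢i; any?)
open import Data.Fin.Subset using (Subset; _∈_; _∉_; _⊆_; _⊂_; ∣_∣; ⁅_⁆; _∪_; _-_)
open import Data.Fin.Subset.Properties
  using ( _∈?_; x∈p⇒∣p-x∣<∣p∣; x∈p∧x≢y⇒x∈p-y; x∈p⇒p-x⊂p; p─q⊆p
        ; x∈⁅x⁆; x∈⁅y⁆⇒x≡y; x∈p∪q⁺; x∈p∪q⁻ )
open import Data.Fin.Subset.Induction using (⊂-wellFounded; Acc; acc)
open import Data.List using (List; []; _∷_; foldr; tabulate; allFin; filter)
import Data.List.Membership.Propositional as List
open import Data.List.Membership.Propositional.Properties using (∈-allFin; ∈-filter⁺)
open import Data.List.Relation.Unary.Any using (here; there)
open import Data.List.Relation.Unary.All as All using (All)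
open import Data.List.Relation.Unary.All.Properties using (all-filter)
open import Data.List.Extrema ≤-totalOrder
  using (argmax; argmin; argmax-all; argmin-all; f[xs]≤f[argmax]; f[argmin]≤f[xs])
import Data.Vec as Vec
open import Data.Vec using (_∷_; here; there)
open import Data.Vec.Properties using (lookup∘tabulate; lookup⇒[]=; []=⇒lookup)
open import Data.Vec.Functional using (updateAt)
open import Data.Vec.Functional.Properties using (updateAt-updates; updateAt-minimal)
open import Algebra.Properties.CommutativeMonoid.Sum +-0-commutativeMonoid
  using (sum; sum-syntax; sum-cong-≗; sum-replicate-zero; sum-remove; ∑-distrib-+; ∑-comm)
open import Relation.Nullary using (¬_; does; yes; no; _×-dec_; ¬?; contradiction)
open import Relation.Nullary.Decidable using (dec-true)
open import Relation.Unary using (Pred; Decidable)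
open import Relation.Binary.Definitions using () renaming (Decidable to Decidable₂)
open import Relation.Binary.Lattice.Structures using (IsLattice)
open import Relation.Binary.PropositionalEquality hiding (J)

open import Defs hiding (_≺_; _≺?_)
import Defs

x∈p-y⇒x≢y : ∀ {n} {p : Subset n} {x y : Fin n} → x ∈ p - y → x ≢ y
x∈p-y⇒x≢y {p = _ ∷ _} {zero}  {zero}  ()
x∈p-y⇒x≢y {p = _ ∷ _} {suc x} {suc y} (there x∈) refl = x∈p-y⇒x≢y x∈ refl

two≤∣p∣ : ∀ {n} {p : Subset n} {x y : Fin n} → x ∈ p → y ∈ p → y ≢ x → 2 ≤ ∣ p ∣
-- ∣ p ∣ > ∣ p - x ∣ > ∣ p - x - y ∣
two≤∣p∣ x∈p y∈p y≢x =
  ≤-trans (s≤s (≤-trans (s≤s z≤n) (x∈p⇒∣p-x∣<∣p∣ (x∈p∧x≢y⇒x∈p-y y∈p y≢x)))) (x∈p⇒∣p-x∣<∣p∣ x∈p)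

⟦_⟧ : ∀ {n p} {P : Pred (Fin n) p} → Decidable P → Subset n
⟦ P? ⟧ = Vec.tabulate (does ∘ P?)

module _ {n : ℕ} {p : Level} {P : Pred (Fin n) p} (P? : Decidable P) where

  ∈⟦⟧⁺ : ∀ {k} → P k → k ∈ ⟦ P? ⟧
  ∈⟦⟧⁺ {k} pk = lookup⇒[]= k ⟦ P? ⟧ (trans (lookup∘tabulate (does ∘ P?) k) (dec-true (P? k) pk))

  ∈⟦⟧⁻ : ∀ {k} → k ∈ ⟦ P? ⟧ → P k
  ∈⟦⟧⁻ {k} k∈ with P? k | trans (sym (lookup∘tabulate (does ∘ P?) k)) ([]=⇒lookup k∈)
  ... | yes pk | _  = pk
  ... | no _   | ()

module _ {n : ℕ} {p : Level} {P : Pred (Fin n) p} (P? : Decidable P) (f : Fin n → ℕ)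
         {k₀ : Fin n} (pk₀ : P k₀) where

  private
    candidates : List (Fin n)
    candidates = filter P? (allFin n)

    ∈-candidates : ∀ {k} → P k → k List.∈ candidates
    ∈-candidates = ∈-filter⁺ P? (∈-allFin _)

  maximiser : ∃ λ m → P m × ∀ {k} → P k → f k ≤ f m
  maximiser = argmax f k₀ candidates
            , argmax-all f pk₀ (all-filter P? (allFin n))
            , All.lookup (f[xs]≤f[argmax] k₀ candidates) ∘ ∈-candidates

  minimiser : ∃ λ m → P m × ∀ {k} → P k → f m ≤ f k
  minimiser = argmin f k₀ candidates
            , argmin-all f pk₀ (all-filter P? (allFin n))
            , All.lookup (f[argmin]≤f[xs] k₀ candidates) ∘ ∈-candidates

module _ {n : ℕ} {p : Level} {P : Pred (Fin n) p} where

  restrict : Decidable P → (Fin n → ℕ) → Fin n → ℕ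
  restrict P? f k = if does (P? k) then f k else 0

  restrict-∈ : (P? : Decidable P) (f : Fin n → ℕ) {k : Fin n} → P k → restrict P? f k ≡ f k
  restrict-∈ P? f {k} pk with P? k
  ... | yes _  = refl
  ... | no ¬pk = contradiction pk ¬pk

  restrict-∉ : (P? : Decidable P) (f : Fin n → ℕ) {k : Fin n} → ¬ P k → restrict P? f k ≡ 0
  restrict-∉ P? f {k} ¬pk with P? k
  ... | yes pk = contradiction pk ¬pk
  ... | no _   = refl

infix 8 ∑⟨_⟩_
∑⟨_⟩_ : ∀ {n p} {P : Pred (Fin n) p} → Decidable P → (Fin n → ℕ) → ℕ
∑⟨ P? ⟩ f = sum (restrict P? f)

module _ {n : ℕ} {p q : Level} {P : Pred (Fin n) p} {Q : Pred (Fin n) q}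
         (P? : Decidable P) (Q? : Decidable Q) where

  ∑⟨⟩-cong : {f g : Fin n → ℕ} → (∀ {k} → P k → Q k) → (∀ {k} → Q k → P k)
           → (∀ {k} → P k → f k ≡ g k) → ∑⟨ P? ⟩ f ≡ ∑⟨ Q? ⟩ g
  ∑⟨⟩-cong {f} {g} P⇒Q Q⇒P f≡g = sum-cong-≗ pointwise
    where
    pointwise : ∀ k → restrict P? f k ≡ restrict Q? g k
    pointwise k with P? k
    ... | yes pk = trans (f≡g pk) (sym (restrict-∈ Q? g (P⇒Q pk)))
    ... | no ¬pk = sym (restrict-∉ Q? g (¬pk ∘ Q⇒P))

module _ {n : ℕ} {p : Level} {P : Pred (Fin n) p} (P? : Decidable P) where

  ∑⟨⟩-empty : {f : Fin n → ℕ} → (∀ k → ¬ P k) → ∑⟨ P? ⟩ f ≡ 0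
  ∑⟨⟩-empty {f} none = trans (sum-cong-≗ (λ k → restrict-∉ P? f (none k))) (sum-replicate-zero n)

  ∑⟨⟩-distrib-+ : (f g : Fin n → ℕ) → ∑⟨ P? ⟩ (λ k → f k + g k) ≡ ∑⟨ P? ⟩ f + ∑⟨ P? ⟩ g
  ∑⟨⟩-distrib-+ f g = trans (sum-cong-≗ pointwise) (∑-distrib-+ (restrict P? f) (restrict P? g))
    where
    pointwise : ∀ k → restrict P? (λ k → f k + g k) k ≡ restrict P? f k + restrict P? g k
    pointwise k with P? k
    ... | yes _ = refl
    ... | no _  = refl

∑⟨⟩-singleton : ∀ {n p} {P : Pred (Fin n) p} (P? : Decidable P) {f : Fin n → ℕ} {i : Fin n}
              → P i → (∀ {k} → P k → k ≡ i) → ∑⟨ P? ⟩ f ≡ f i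
∑⟨⟩-singleton {suc n} P? {f} {i} pi only = begin
  sum t                                ≡⟨ sum-remove t ⟩
  t i + sum (t ∘ punchIn i)            ≡⟨ cong₂ _+_ (restrict-∈ P? f pi) rest-vanishes ⟩
  f i + 0                              ≡⟨ +-identityʳ (f i) ⟩
  f i                                  ∎
  where
  open ≡-Reasoning
  t : Fin (suc n) → ℕ
  t = restrict P? f
  rest-vanishes : sum (t ∘ punchIn i) ≡ 0
  rest-vanishes = trans (sum-cong-≗ (λ j → restrict-∉ P? f (punchInᵢ≢i i j ∘ only)))
                        (sum-replicate-zero n)

∑⟨∈⟩-remove : ∀ {n} {A : Subset n} {f : Fin n → ℕ} {i : Fin n} → i ∈ A
            → ∑⟨ _∈? A ⟩ f ≡ f i + ∑⟨ _∈? (A - i) ⟩ f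
∑⟨∈⟩-remove {n} {A} {f} {i} i∈A = begin
  ∑⟨ _∈? A ⟩ f                      ≡⟨ sum-cong-≗ split ⟩
  sum (λ k → at-i k + off-i k)      ≡⟨ ∑-distrib-+ at-i off-i ⟩
  sum at-i + sum off-i              ≡⟨ cong (_+ sum off-i) (∑⟨⟩-singleton (_≟ i) refl id) ⟩
  f i + ∑⟨ _∈? (A - i) ⟩ f          ∎
  where
  open ≡-Reasoning
  at-i off-i : Fin n → ℕ
  at-i  = restrict (_≟ i) f
  off-i = restrict (_∈? (A - i)) f

  split : ∀ k → restrict (_∈? A) f k ≡ at-i k + off-i k
  split k with k ≟ i | k ∈? A
  ... | yes refl | yes _   = sym (trans (cong (f i +_) (restrict-∉ (_∈? (A - i)) f (flip x∈p-y⇒x≢y refl)))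
                                        (+-identityʳ (f i)))
  ... | yes refl | no i∉A  = contradiction i∈A i∉A
  ... | no k≢i   | yes k∈A = sym (restrict-∈ (_∈? (A - i)) f (x∈p∧x≢y⇒x∈p-y k∈A k≢i))
  ... | no _     | no k∉A  = sym (restrict-∉ (_∈? (A - i)) f (k∉A ∘ p─q⊆p A ⁅ i ⁆))

sumOver≡∑⟨∈⟩ : ∀ {n} (L : GeomLattice n) (S : Subset n) (f : Fin n → ℕ) → sumOver L S f ≡ ∑⟨ _∈? S ⟩ f
sumOver≡∑⟨∈⟩ {n} L S f = go id
  where
  go : ∀ {m} (g : Fin m → Fin n)
     → foldr (λ i acc → if does (i ∈? S) then f i + acc else acc) 0 (tabulate g)
     ≡ sum (restrict (_∈? S) f ∘ g)
  go {zero}  g = refl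
  go {suc m} g with g zero ∈? S
  ... | yes _ = cong (f (g zero) +_) (go (g ∘ suc))
  ... | no _  = go (g ∘ suc)

-- Bounds g y − g x ≤ h y − h x on differences compose; stated additively.
+-gap-trans : ∀ {a} {A : Set a} (g h : A → ℕ) {x y z : A}
            → g y + h x ≤ h y + g x → g z + h y ≤ h z + g y → g z + h x ≤ h z + g x
+-gap-trans g h {x} {y} {z} lower upper =
  +-cancelˡ-≤ (g y + h y) (g z + h x) (h z + g x)
    (subst₂ _≤_ (regroupˡ (g y) (h x) (g z) (h y)) (regroupʳ (h y) (g x) (h z) (g y))
            (+-mono-≤ lower upper))
  where
  regroupˡ : ∀ gy hx gz hy → (gy + hx) + (gz + hy) ≡ (gy + hy) + (gz + hx)
  regroupˡ = solve-∀
  regroupʳ : ∀ hy gx hz gy → (hy + gx) + (hz + gy) ≡ (gy + hy) + (hz + gx)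
  regroupʳ = solve-∀

module GeomLatticeProperties {n : ℕ} (L : GeomLattice n) where

  open GeomLattice L
  open IsLattice isLattice public
    using (x≤x∨y; y≤x∨y; ∨-least; antisym) renaming (refl to ≼-refl; trans to ≼-trans)

  infix 4 _≺_ _≺?_
  _≺_ : Fin n → Fin n → Set
  _≺_ = Defs._≺_ L

  _≺?_ : Decidable₂ _≺_
  _≺?_ = Defs._≺?_ L

  ≼-⊥ : ∀ {x} → x ≼ ⊥ → x ≡ ⊥
  ≼-⊥ x≼⊥ = antisym x≼⊥ (⊥-min _)

  module _ {p : Level} {P : Pred (Fin n) p} (P? : Decidable P) where

    ⋁ᵖ : Fin n
    ⋁ᵖ = foldr (λ i acc → if does (P? i) then i ∨ acc else acc) ⊥ (allFin n)

    private
      joinOf : List (Fin n) → Fin n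
      joinOf = foldr (λ i acc → if does (P? i) then i ∨ acc else acc) ⊥

      joinOf-upper : ∀ {k} xs → k List.∈ xs → P k → k ≼ joinOf xs
      joinOf-upper (x ∷ xs) (here refl) pk with P? x
      ... | yes _  = x≤x∨y _ _
      ... | no ¬pk = contradiction pk ¬pk
      joinOf-upper (x ∷ xs) (there k∈xs) pk with P? x
      ... | yes _ = ≼-trans (joinOf-upper xs k∈xs pk) (y≤x∨y _ _)
      ... | no _  = joinOf-upper xs k∈xs pk

      joinOf-least : ∀ {w} xs → (∀ {k} → P k → k ≼ w) → joinOf xs ≼ w
      joinOf-least []       _     = ⊥-min _
      joinOf-least (x ∷ xs) below with P? x
      ... | yes px = ∨-least (below px) (joinOf-least xs below)
      ... | no _   = joinOf-least xs below

    ≼-⋁ᵖ : ∀ {k} → P k → k ≼ ⋁ᵖ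
    ≼-⋁ᵖ = joinOf-upper (allFin n) (∈-allFin _)

    ⋁ᵖ-least : ∀ {w} → (∀ {k} → P k → k ≼ w) → ⋁ᵖ ≼ w
    ⋁ᵖ-least = joinOf-least (allFin n)

  ≼-⋁ : ∀ {A k} → k ∈ A → k ≼ ⋁ L A
  ≼-⋁ {A} = ≼-⋁ᵖ (_∈? A)

  ⋁-least : ∀ {A w} → (∀ {k} → k ∈ A → k ≼ w) → ⋁ L A ≼ w
  ⋁-least {A} = ⋁ᵖ-least (_∈? A)

  module _ {ℓ : Level} (R : Fin n → Fin n → Set ℓ)
           (R-refl : ∀ {a} → R a a)
           (R-cover : ∀ {a b} → a ≼ b → a ≢ b → (∀ z → a ≼ z → z ≼ b → z ≡ a ⊎ z ≡ b) → R a b)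
           (R-trans : ∀ {a w b} → a ≺ w → w ≺ b → R a w → R w b → R a b) where

    private
      between? : ∀ a b → Decidable (λ z → a ≼ z × z ≼ b)
      between? a b z = (a ≼? z) ×-dec (z ≼? b)

      interval : Fin n → Fin n → Subset n
      interval a b = ⟦ between? a b ⟧

      go : ∀ {a b} → Acc _⊂_ (interval a b) → a ≼ b → R a b
      go {a} {b} (acc smaller) a≼b with a ≟ b
      ... | yes refl = R-refl
      ... | no a≢b with any? (λ w → (a ≺? w) ×-dec (w ≺? b))
      ...   | yes (w , a≺w@(a≼w , a≢w) , w≺b@(w≼b , w≢b)) =
              R-trans a≺w w≺b (go (smaller lower⊂) a≼w) (go (smaller upper⊂) w≼b)
        where
        lower⊂ : interval a w ⊂ interval a b
        lower⊂ = (λ z∈ → let (a≼z , z≼w) = ∈⟦⟧⁻ (between? a w) z∈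
                         in ∈⟦⟧⁺ (between? a b) (a≼z , ≼-trans z≼w w≼b))
               , b , ∈⟦⟧⁺ (between? a b) (a≼b , ≼-refl)
               , λ b∈ → w≢b (antisym w≼b (proj₂ (∈⟦⟧⁻ (between? a w) b∈)))
        upper⊂ : interval w b ⊂ interval a b
        upper⊂ = (λ z∈ → let (w≼z , z≼b) = ∈⟦⟧⁻ (between? w b) z∈
                         in ∈⟦⟧⁺ (between? a b) (≼-trans a≼w w≼z , z≼b))
               , a , ∈⟦⟧⁺ (between? a b) (≼-refl , a≼b)
               , λ a∈ → a≢w (antisym a≼w (proj₁ (∈⟦⟧⁻ (between? w b) a∈)))
      ...   | no nothing-between = R-cover a≼b a≢b covers
        where
        covers : ∀ z → a ≼ z → z ≼ b → z ≡ a ⊎ z ≡ b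
        covers z a≼z z≼b with z ≟ a | z ≟ b
        ... | yes z≡a | _       = inj₁ z≡a
        ... | no _    | yes z≡b = inj₂ z≡b
        ... | no z≢a  | no z≢b  = contradiction (z , (a≼z , z≢a ∘ sym) , (z≼b , z≢b)) nothing-between

    ≼-induction : ∀ {a b} → a ≼ b → R a b
    ≼-induction = go (⊂-wellFounded _)

  ≼⇒≡⊎ρ< : ∀ {a b} → a ≼ b → a ≡ b ⊎ ρ a < ρ b
  ≼⇒≡⊎ρ< = ≼-induction (λ a b → a ≡ b ⊎ ρ a < ρ b) (inj₁ refl) cover compose
    where
    cover : ∀ {a b} → a ≼ b → a ≢ b → (∀ z → a ≼ z → z ≼ b → z ≡ a ⊎ z ≡ b) → a ≡ b ⊎ ρ a < ρ b
    cover {a} {b} a≼b a≢b covers = inj₂ (≤-reflexive (sym (ρ-cover a b a≼b a≢b covers)))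
    compose : ∀ {a w b} → a ≺ w → w ≺ b → a ≡ w ⊎ ρ a < ρ w → w ≡ b ⊎ ρ w < ρ b → a ≡ b ⊎ ρ a < ρ b
    compose (_ , a≢w) _         (inj₁ a≡w) _          = contradiction a≡w a≢w
    compose _         (_ , w≢b) _          (inj₁ w≡b) = contradiction w≡b w≢b
    compose _         _         (inj₂ a<w) (inj₂ w<b) = inj₂ (<-trans a<w w<b)

  ρ-strictMono : ∀ {a b} → a ≺ b → ρ a < ρ b
  ρ-strictMono (a≼b , a≢b) = [ flip contradiction a≢b , id ]′ (≼⇒≡⊎ρ< a≼b)

  ρ-mono : ∀ {a b} → a ≼ b → ρ a ≤ ρ b
  ρ-mono a≼b = [ ≤-reflexive ∘ cong ρ , <⇒≤ ]′ (≼⇒≡⊎ρ< a≼b)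

  ≼∧ρ-≥⇒≡ : ∀ {a b} → a ≼ b → ρ b ≤ ρ a → a ≡ b
  ≼∧ρ-≥⇒≡ a≼b ρb≤ρa = [ id , flip contradiction (≤⇒≯ ρb≤ρa) ]′ (≼⇒≡⊎ρ< a≼b)

  ≺⇒≢⊤ : ∀ {a b} → a ≺ b → a ≢ ⊤
  ≺⇒≢⊤ {b = b} (a≼b , a≢b) refl = a≢b (antisym a≼b (⊤-max b))

  module _ {p : Level} {Q : Pred (Fin n) p} (Q? : Decidable Q) {k₀ : Fin n} (qk₀ : Q k₀) where

    ∃-maximal : ∃ λ m → Q m × ∀ {k} → Q k → m ≼ k → m ≡ k
    ∃-maximal = let (m , qm , ρ-max) = maximiser Q? ρ qk₀
                in m , qm , λ qk m≼k → ≼∧ρ-≥⇒≡ m≼k (ρ-max qk)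

    ∃-minimal : ∃ λ m → Q m × ∀ {k} → Q k → k ≼ m → k ≡ m
    ∃-minimal = let (m , qm , ρ-min) = minimiser Q? ρ qk₀
                in m , qm , λ qk k≼m → ≼∧ρ-≥⇒≡ k≼m (ρ-min qk)

  module _ {i : Fin n} (f : Fin n → Fin n) (f-strictMono : ∀ {a b} → a ≺ b → b ≼ i → f a ≺ f b) where

    -- rk [a , b] ≤ rk [f a , f b], stated additively to avoid truncated subtraction.
    ρ-gap≤ρ-gap-image : ∀ {a b} → a ≼ b → b ≼ i → ρ b + ρ (f a) ≤ ρ (f b) + ρ a
    ρ-gap≤ρ-gap-image = ≼-induction (λ a b → b ≼ i → ρ b + ρ (f a) ≤ ρ (f b) + ρ a)
      (λ {a} _ → ≤-reflexive (+-comm (ρ a) (ρ (f a)))) cover compose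
      where
      cover : ∀ {a b} → a ≼ b → a ≢ b → (∀ z → a ≼ z → z ≼ b → z ≡ a ⊎ z ≡ b)
            → b ≼ i → ρ b + ρ (f a) ≤ ρ (f b) + ρ a
      cover {a} {b} a≼b a≢b covers b≼i = begin
        ρ b + ρ (f a)        ≡⟨ cong (_+ ρ (f a)) (ρ-cover a b a≼b a≢b covers) ⟩
        suc (ρ a + ρ (f a))  ≡⟨ cong suc (+-comm (ρ a) (ρ (f a))) ⟩
        suc (ρ (f a)) + ρ a  ≤⟨ +-monoˡ-≤ (ρ a) (ρ-strictMono (f-strictMono (a≼b , a≢b) b≼i)) ⟩
        ρ (f b) + ρ a        ∎
        where open ≤-Reasoning
      compose : ∀ {a w b} → a ≺ w → w ≺ b
              → (w ≼ i → ρ w + ρ (f a) ≤ ρ (f w) + ρ a) → (b ≼ i → ρ b + ρ (f w) ≤ ρ (f b) + ρ w)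
              → b ≼ i → ρ b + ρ (f a) ≤ ρ (f b) + ρ a
      compose _ (w≼b , _) lower upper b≼i = +-gap-trans ρ (ρ ∘ f) (lower (≼-trans w≼b b≼i)) (upper b≼i)

module BuildingSetProperties {n : ℕ} (L : GeomLattice n) (G : Subset n) (building : IsBuildingSet L G)
  where

  open GeomLattice L
  open GeomLatticeProperties L

  ∈G⇒≢⊥ : ∀ {g} → g ∈ G → g ≢ ⊥
  ∈G⇒≢⊥ = proj₁ building _

  factor-above : ∀ {g X} → g ∈ G → g ≼ X → ∃ λ F → Fact L G X F × g ≼ F
  factor-above {g} {X} g∈G g≼X =
    let (F , (F∈G , g≼F , F≼X) , F-max) = ∃-maximal (λ F → (F ∈? G) ×-dec ((g ≼? F) ×-dec (F ≼? X)))
                                                    (g∈G , ≼-refl , g≼X)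
    in F , (F∈G , F≼X , λ j j∈G j≼X F≼j → F-max (j∈G , ≼-trans g≼F F≼j , j≼X) F≼j) , g≼F

  factorisation-unique : ∀ {X Y F} {y z : Fin n → Fin n}
    → InProd L (Fact L G X) y → InProd L (Fact L G X) z
    → IsJoinFam L (Fact L G X) y Y → IsJoinFam L (Fact L G X) z Y
    → Fact L G X F → y F ≡ z F
  factorisation-unique {X} {Y} {F} {y} {z} y∈ z∈ y⋁ z⋁ fF =
    antisym (reflects y z Y Y y∈ z∈ y⋁ z⋁ ≼-refl F fF) (reflects z y Y Y z∈ y∈ z⋁ y⋁ ≼-refl F fF)
    where
    reflects : ∀ y z Y Z → InProd L (Fact L G X) y → InProd L (Fact L G X) z
             → IsJoinFam L (Fact L G X) y Y → IsJoinFam L (Fact L G X) z Z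
             → Y ≼ Z → ∀ i → Fact L G X i → y i ≼ z i
    reflects = proj₂ (proj₂ building X)

  updateAt-InProd : ∀ {X F c} {y : Fin n → Fin n} → InProd L (Fact L G X) y → c ≼ F
                  → InProd L (Fact L G X) (updateAt y F (const c))
  updateAt-InProd {F = F} {y = y} y∈ c≼F k fk with k ≟ F
  ... | yes refl = subst (_≼ k) (sym (updateAt-updates k y)) c≼F
  ... | no k≢F   = subst (_≼ k) (sym (updateAt-minimal k F y k≢F)) (y∈ k fk)

  factors-disjoint : ∀ {X F₁ F₂ g} → Fact L G X F₁ → Fact L G X F₂ → F₁ ≢ F₂
                   → g ≼ F₁ → g ≼ F₂ → g ≡ ⊥
  factors-disjoint {X} {F₁} {F₂} {g} fF₁ fF₂ F₁≢F₂ g≼F₁ g≼F₂ = begin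
    g                    ≡⟨ updateAt-updates F₁ (const ⊥) ⟨
    only F₁ F₁           ≡⟨ factorisation-unique (only-InProd g≼F₁) (only-InProd g≼F₂)
                                                 (only-joins fF₁) (only-joins fF₂) fF₁ ⟩
    only F₂ F₁           ≡⟨ updateAt-minimal F₁ F₂ (const ⊥) F₁≢F₂ ⟩
    ⊥                    ∎
    where
    open ≡-Reasoning
    only : Fin n → Fin n → Fin n
    only F = updateAt (const ⊥) F (const g)

    only-InProd : ∀ {F} → g ≼ F → InProd L (Fact L G X) (only F)
    only-InProd = updateAt-InProd (λ k _ → ⊥-min k)

    only-joins : ∀ {F} → Fact L G X F → IsJoinFam L (Fact L G X) (only F) g
    only-joins {F} fF = (λ k _ → below k)
                      , λ w above → subst (_≼ w) (updateAt-updates F (const ⊥)) (above F fF)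
      where
      below : ∀ k → only F k ≼ g
      below k with k ≟ F
      ... | yes refl = subst (_≼ g) (sym (updateAt-updates k (const ⊥))) ≼-refl
      ... | no k≢F   = subst (_≼ g) (sym (updateAt-minimal k F (const ⊥) k≢F)) (⊥-min g)

  ∨-∈G : ∀ {g H₁ H₂} → g ∈ G → H₁ ∈ G → H₂ ∈ G → g ≼ H₁ → g ≼ H₂ → H₁ ∨ H₂ ∈ G
  ∨-∈G {g} {H₁} {H₂} g∈G H₁∈G H₂∈G g≼H₁ g≼H₂
    with factor-above H₁∈G (x≤x∨y H₁ H₂) | factor-above H₂∈G (y≤x∨y H₁ H₂)
  ... | F₁ , fF₁@(F₁∈G , F₁≼H₁∨H₂ , _) , H₁≼F₁ | F₂ , fF₂ , H₂≼F₂ with F₁ ≟ F₂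
  ...   | yes refl = subst (_∈ G) (antisym F₁≼H₁∨H₂ (∨-least H₁≼F₁ H₂≼F₂)) F₁∈G
  ...   | no F₁≢F₂ = contradiction
                       (factors-disjoint fF₁ fF₂ F₁≢F₂ (≼-trans g≼H₁ H₁≼F₁) (≼-trans g≼H₂ H₂≼F₂))
                       (∈G⇒≢⊥ g∈G)

module NestedSetProperties {n : ℕ} (L : GeomLattice n) (G S : Subset n)
                           (building : IsBuildingSet L G) (nested : IsNested L G S) where

  open GeomLattice L
  open GeomLatticeProperties L
  open BuildingSetProperties L G building

  S⊆G : S ⊆ G
  S⊆G = proj₁ nested

  ⋁-antichain∉G : ∀ {A x y} → A ⊆ S → IsAntichain L A → x ∈ A → y ∈ A → y ≢ x → ⋁ L A ∉ G
  ⋁-antichain∉G A⊆S anti x∈A y∈A y≢x = proj₂ nested _ A⊆S (two≤∣p∣ x∈A y∈A y≢x) anti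

  nested-comparable : ∀ {g H₁ H₂} → g ∈ S → H₁ ∈ S → H₂ ∈ S → g ≼ H₁ → g ≼ H₂ → H₁ ≼ H₂ ⊎ H₂ ≼ H₁
  nested-comparable {g} {H₁} {H₂} g∈S H₁∈S H₂∈S g≼H₁ g≼H₂ with H₁ ≼? H₂ | H₂ ≼? H₁
  ... | yes H₁≼H₂ | _         = inj₁ H₁≼H₂
  ... | no _      | yes H₂≼H₁ = inj₂ H₂≼H₁
  ... | no H₁⋠H₂  | no H₂⋠H₁  =
    contradiction (subst (_∈ G) (sym ⋁pair) (∨-∈G (S⊆G g∈S) (S⊆G H₁∈S) (S⊆G H₂∈S) g≼H₁ g≼H₂))
                  (⋁-antichain∉G pair⊆S antichain H₁∈pair H₂∈pair λ { refl → H₁⋠H₂ ≼-refl })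
    where
    pair : Subset n
    pair = ⁅ H₁ ⁆ ∪ ⁅ H₂ ⁆

    H₁∈pair : H₁ ∈ pair
    H₁∈pair = x∈p∪q⁺ (inj₁ (x∈⁅x⁆ H₁))

    H₂∈pair : H₂ ∈ pair
    H₂∈pair = x∈p∪q⁺ (inj₂ (x∈⁅x⁆ H₂))

    pair-cases : ∀ {k} → k ∈ pair → k ≡ H₁ ⊎ k ≡ H₂
    pair-cases k∈ = Sum.map (x∈⁅y⁆⇒x≡y H₁) (x∈⁅y⁆⇒x≡y H₂) (x∈p∪q⁻ ⁅ H₁ ⁆ ⁅ H₂ ⁆ k∈)

    pair⊆S : pair ⊆ S
    pair⊆S k∈ with pair-cases k∈
    ... | inj₁ refl = H₁∈S
    ... | inj₂ refl = H₂∈S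

    antichain : IsAntichain L pair
    antichain i j i∈ j∈ i≼j with pair-cases i∈ | pair-cases j∈
    ... | inj₁ refl | inj₁ refl = refl
    ... | inj₁ refl | inj₂ refl = contradiction i≼j H₁⋠H₂
    ... | inj₂ refl | inj₁ refl = contradiction i≼j H₂⋠H₁
    ... | inj₂ refl | inj₂ refl = refl

    ⋁pair : ⋁ L pair ≡ H₁ ∨ H₂
    ⋁pair = antisym
      (⋁-least λ k∈ → [ (λ { refl → x≤x∨y H₁ H₂ }) , (λ { refl → y≤x∨y H₁ H₂ }) ]′ (pair-cases k∈))
      (∨-least (≼-⋁ H₁∈pair) (≼-⋁ H₂∈pair))

  module _ {A : Subset n} (A⊆S : A ⊆ S) (antichain : IsAntichain L A) where

    private
      below? : ∀ F → Decidable (λ k → k ∈ A × k ≼ F)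
      below? F k = (k ∈? A) ×-dec (k ≼? F)

      part : Fin n → Fin n
      part F = ⋁ L ⟦ below? F ⟧

      ≼-part : ∀ {F k} → k ∈ A → k ≼ F → k ≼ part F
      ≼-part {F} k∈A k≼F = ≼-⋁ (∈⟦⟧⁺ (below? F) (k∈A , k≼F))

      part-least : ∀ {F w} → (∀ {k} → k ∈ A → k ≼ F → k ≼ w) → part F ≼ w
      part-least {F} below = ⋁-least λ k∈ → let (k∈A , k≼F) = ∈⟦⟧⁻ (below? F) k∈ in below k∈A k≼F

      below⊆S : ∀ {F} → ⟦ below? F ⟧ ⊆ S
      below⊆S {F} = A⊆S ∘ proj₁ ∘ ∈⟦⟧⁻ (below? F)

      below-antichain : ∀ {F} → IsAntichain L ⟦ below? F ⟧
      below-antichain {F} i j i∈ j∈ =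
        antichain i j (proj₁ (∈⟦⟧⁻ (below? F) i∈)) (proj₁ (∈⟦⟧⁻ (below? F) j∈))

      factor-above-member : ∀ {a} → a ∈ A → ∃ λ F → Fact L G (⋁ L A) F × a ≼ F
      factor-above-member a∈A = factor-above (S⊆G (A⊆S a∈A)) (≼-⋁ a∈A)

    factor≡part : ∀ {F} → Fact L G (⋁ L A) F → F ≡ part F
    factor≡part = factorisation-unique (λ _ _ → ≼-refl) (λ _ _ → part-least λ _ k≼F → k≼F)
                                       id-joins part-joins
      where
      id-joins : IsJoinFam L (Fact L G (⋁ L A)) id (⋁ L A)
      id-joins = (λ _ (_ , F≼X , _) → F≼X)
               , λ w above → ⋁-least λ a∈A →
                   let (F , fF , a≼F) = factor-above-member a∈A in ≼-trans a≼F (above F fF)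
      part-joins : IsJoinFam L (Fact L G (⋁ L A)) part (⋁ L A)
      part-joins = (λ _ _ → part-least λ k∈A _ → ≼-⋁ k∈A)
                 , λ w above → ⋁-least λ a∈A →
                     let (F , fF , a≼F) = factor-above-member a∈A
                     in ≼-trans (≼-part a∈A a≼F) (above F fF)

    member⇒factor : ∀ {a} → a ∈ A → Fact L G (⋁ L A) a
    member⇒factor {a} a∈A = S⊆G (A⊆S a∈A) , ≼-⋁ a∈A , maximal
      where
      maximal : ∀ j → j ∈ G → j ≼ ⋁ L A → a ≼ j → a ≡ j
      maximal j j∈G j≼X a≼j with factor-above j∈G j≼X
      ... | F , fF@(F∈G , _) , j≼F =
        antisym a≼j (≼-trans j≼F (subst (_≼ a) (sym (factor≡part fF)) (part-least only-a)))
        where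
        only-a : ∀ {b} → b ∈ A → b ≼ F → b ≼ a
        only-a {b} b∈A b≼F with b ≟ a
        ... | yes refl = ≼-refl
        ... | no b≢a   = contradiction (subst (_∈ G) (factor≡part fF) F∈G)
                           (⋁-antichain∉G below⊆S below-antichain
                                          (∈⟦⟧⁺ (below? F) (a∈A , ≼-trans a≼j j≼F))
                                          (∈⟦⟧⁺ (below? F) (b∈A , b≼F)) b≢a)

    factor⇒member : ∀ {F} → Fact L G (⋁ L A) F → F ∈ A
    factor⇒member {F} fF@(F∈G , F≼X , _) with any? (below? F)
    ... | yes (a , a∈A , a≼F) = subst (_∈ A) (proj₂ (proj₂ (member⇒factor a∈A)) F F∈G F≼X a≼F) a∈A
    ... | no nothing-below    = contradiction F≡⊥ (∈G⇒≢⊥ F∈G)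
      where
      F≡⊥ : F ≡ ⊥
      F≡⊥ = ≼-⊥ (subst (_≼ ⊥) (sym (factor≡part fF))
                       (part-least λ k∈A k≼F → contradiction (_ , k∈A , k≼F) nothing-below))

    module _ {i : Fin n} (i∈A : i ∈ A) where

      private
        J : Fin n
        J = ⋁ L (A - i)

        J-member : ∀ {k} → k ∈ A → k ≢ i → k ≼ J
        J-member k∈A k≢i = ≼-⋁ (x∈p∧x≢y⇒x∈p-y k∈A k≢i)

        replace : Fin n → Fin n → Fin n
        replace c = updateAt id i (const c)

        replace-joins : ∀ c → IsJoinFam L (Fact L G (⋁ L A)) (replace c) (J ∨ c)
        replace-joins c = (λ k fk → upper k (factor⇒member fk)) , least
          where
          upper : ∀ k → k ∈ A → replace c k ≼ J ∨ c
          upper k k∈A with k ≟ i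
          ... | yes refl = subst (_≼ J ∨ c) (sym (updateAt-updates i id)) (y≤x∨y J c)
          ... | no k≢i   = subst (_≼ J ∨ c) (sym (updateAt-minimal k i id k≢i))
                                 (≼-trans (J-member k∈A k≢i) (x≤x∨y J c))
          least : ∀ w → (∀ k → Fact L G (⋁ L A) k → replace c k ≼ w) → J ∨ c ≼ w
          least w above = ∨-least
            (⋁-least λ {k} k∈ → subst (_≼ w) (updateAt-minimal k i id (x∈p-y⇒x≢y k∈))
                                            (above k (member⇒factor (p─q⊆p A ⁅ i ⁆ k∈))))
            (subst (_≼ w) (updateAt-updates i id) (above i (member⇒factor i∈A)))

      ⋁≡⋁-∨ : ⋁ L A ≡ ⋁ L (A - i) ∨ i
      ⋁≡⋁-∨ = antisym (⋁-least below) (∨-least (⋁-least (≼-⋁ ∘ p─q⊆p A ⁅ i ⁆)) (≼-⋁ i∈A))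
        where
        below : ∀ {k} → k ∈ A → k ≼ J ∨ i
        below {k} k∈A with k ≟ i
        ... | yes refl = y≤x∨y J i
        ... | no k≢i   = ≼-trans (J-member k∈A k≢i) (x≤x∨y J i)

      -- J ∨ c joins the factors of ⋁ A with the factor i replaced by c, so uniqueness of
      -- factorisations makes c ↦ J ∨ c strictly monotone below i.
      ⋁-∨-strictMono : ∀ {a b} → a ≺ b → b ≼ i → ⋁ L (A - i) ∨ a ≺ ⋁ L (A - i) ∨ b
      ⋁-∨-strictMono {a} {b} (a≼b , a≢b) b≼i = ∨-least (x≤x∨y J b) (≼-trans a≼b (y≤x∨y J b))
                                             , λ J∨a≡J∨b → a≢b (begin
        a             ≡⟨ updateAt-updates i id ⟨
        replace a i   ≡⟨ factorisation-unique (updateAt-InProd (λ _ _ → ≼-refl) (≼-trans a≼b b≼i))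
                                              (updateAt-InProd (λ _ _ → ≼-refl) b≼i)
                                              (subst (IsJoinFam L _ (replace a)) J∨a≡J∨b (replace-joins a))
                                              (replace-joins b) (member⇒factor i∈A) ⟩
        replace b i   ≡⟨ updateAt-updates i id ⟩
        b             ∎)
        where open ≡-Reasoning

      ρ-⋁-split : ρ (⋁ L A) ≡ ρ i + ρ (⋁ L (A - i))
      ρ-⋁-split = let open ≡-Reasoning in begin
        ρ (⋁ L A)     ≡⟨ cong ρ ⋁≡⋁-∨ ⟩
        ρ (J ∨ i)     ≡⟨ ≤-antisym (≤-trans (m≤m+n _ _) (submodular J i)) lower-bound ⟩
        ρ J + ρ i     ≡⟨ +-comm (ρ J) (ρ i) ⟩
        ρ i + ρ J     ∎
        where
        lower-bound : ρ J + ρ i ≤ ρ (J ∨ i)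
        lower-bound = begin
          ρ J + ρ i            ≡⟨ +-comm (ρ J) (ρ i) ⟩
          ρ i + ρ J            ≡⟨ cong (λ x → ρ i + ρ x) (antisym (x≤x∨y J ⊥) (∨-least ≼-refl (⊥-min J))) ⟩
          ρ i + ρ (J ∨ ⊥)      ≤⟨ ρ-gap≤ρ-gap-image (J ∨_) ⋁-∨-strictMono (⊥-min i) ≼-refl ⟩
          ρ (J ∨ i) + ρ ⊥      ≡⟨ cong (ρ (J ∨ i) +_) ρ-⊥ ⟩
          ρ (J ∨ i) + 0        ≡⟨ +-identityʳ _ ⟩
          ρ (J ∨ i)            ∎
          where open ≤-Reasoning

  ρ-⋁-antichain : ∀ {A} → A ⊆ S → IsAntichain L A → ρ (⋁ L A) ≡ ∑⟨ _∈? A ⟩ ρ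
  ρ-⋁-antichain = go (⊂-wellFounded _)
    where
    go : ∀ {A} → Acc _⊂_ A → A ⊆ S → IsAntichain L A → ρ (⋁ L A) ≡ ∑⟨ _∈? A ⟩ ρ
    go {A} (acc smaller) A⊆S antichain with any? (_∈? A)
    ... | no empty = begin
      ρ (⋁ L A)     ≡⟨ cong ρ (≼-⊥ (⋁-least λ k∈A → contradiction (_ , k∈A) empty)) ⟩
      ρ ⊥           ≡⟨ ρ-⊥ ⟩
      0             ≡⟨ ∑⟨⟩-empty (_∈? A) (λ k k∈A → empty (k , k∈A)) ⟨
      ∑⟨ _∈? A ⟩ ρ  ∎
      where open ≡-Reasoning
    ... | yes (i , i∈A) = begin
      ρ (⋁ L A)                 ≡⟨ ρ-⋁-split A⊆S antichain i∈A ⟩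
      ρ i + ρ (⋁ L (A - i))     ≡⟨ cong (ρ i +_) (go (smaller (x∈p⇒p-x⊂p i∈A)) (A⊆S ∘ A-i⊆A)
                                    (λ a b a∈ b∈ → antichain a b (A-i⊆A a∈) (A-i⊆A b∈))) ⟩
      ρ i + ∑⟨ _∈? (A - i) ⟩ ρ  ≡⟨ ∑⟨∈⟩-remove i∈A ⟨
      ∑⟨ _∈? A ⟩ ρ              ∎
      where
      open ≡-Reasoning
      A-i⊆A : A - i ⊆ A
      A-i⊆A = p─q⊆p A ⁅ i ⁆

  infix 4 _⋖_ _⋖?_
  _⋖_ : Fin n → Fin n → Set
  C ⋖ H = C ∈ S × H ∈ S × C ≺ H × ¬ (∃ λ K → K ∈ S × C ≺ K × K ≺ H)

  _⋖?_ : Decidable₂ _⋖_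
  C ⋖? H = (C ∈? S) ×-dec (H ∈? S) ×-dec (C ≺? H)
           ×-dec ¬? (any? λ K → (K ∈? S) ×-dec (C ≺? K) ×-dec (K ≺? H))

  children : Fin n → Subset n
  children H = ⟦ (_⋖? H) ⟧

  children-antichain : ∀ {H} → IsAntichain L (children H)
  children-antichain {H} C₁ C₂ C₁∈ C₂∈ C₁≼C₂ with C₁ ≟ C₂
  ... | yes C₁≡C₂ = C₁≡C₂
  ... | no C₁≢C₂  =
    let (_ , _ , _ , nothing-between) = ∈⟦⟧⁻ (_⋖? H) C₁∈
        (C₂∈S , _ , C₂≺H , _)         = ∈⟦⟧⁻ (_⋖? H) C₂∈
    in contradiction (C₂ , C₂∈S , (C₁≼C₂ , C₁≢C₂) , C₂≺H) nothing-between

  below-child : ∀ {k H} → k ∈ S → H ∈ S → k ≺ H → ∃ λ C → C ⋖ H × k ≼ C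
  below-child {k} {H} k∈S H∈S k≺H =
    let (C , (C∈S , k≼C , C≺H) , C-max) = ∃-maximal (λ C → (C ∈? S) ×-dec (k ≼? C) ×-dec (C ≺? H))
                                                    (k∈S , ≼-refl , k≺H)
    in C , (C∈S , H∈S , C≺H , λ (K , K∈S , (C≼K , C≢K) , K≺H) →
                                   C≢K (C-max (K∈S , ≼-trans k≼C C≼K , K≺H) C≼K))
         , k≼C

  τ≡⋁children : ∀ {H} → H ∈ S → τ L S H ≡ ⋁ L (children H)
  τ≡⋁children {H} H∈S = antisym
    (⋁ᵖ-least (λ k → (k ∈? S) ×-dec (k ≺? H)) λ (k∈S , k≺H) →
      let (C , C⋖H , k≼C) = below-child k∈S H∈S k≺H in ≼-trans k≼C (≼-⋁ (∈⟦⟧⁺ (_⋖? H) C⋖H)))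
    (⋁-least λ C∈ → let (C∈S , _ , C≺H , _) = ∈⟦⟧⁻ (_⋖? H) C∈
                    in ≼-⋁ᵖ (λ k → (k ∈? S) ×-dec (k ≺? H)) (C∈S , C≺H))

  τ≼ : ∀ H → τ L S H ≼ H
  τ≼ H = ⋁ᵖ-least (λ k → (k ∈? S) ×-dec (k ≺? H)) (proj₁ ∘ proj₂)

  ρ-τ : ∀ {H} → H ∈ S → ρ (τ L S H) ≡ ∑⟨ (_⋖? H) ⟩ ρ
  ρ-τ {H} H∈S = begin
    ρ (τ L S H)                     ≡⟨ cong ρ (τ≡⋁children H∈S) ⟩
    ρ (⋁ L (children H))            ≡⟨ ρ-⋁-antichain (proj₁ ∘ ∈⟦⟧⁻ (_⋖? H)) (children-antichain {H}) ⟩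
    ∑⟨ _∈? children H ⟩ ρ           ≡⟨ ∑⟨⟩-cong (_∈? children H) (_⋖? H)
                                                 (∈⟦⟧⁻ (_⋖? H)) (∈⟦⟧⁺ (_⋖? H)) (λ _ → refl) ⟩
    ∑⟨ (_⋖? H) ⟩ ρ                  ∎
    where open ≡-Reasoning

  parent-exists : ⊤ ∈ S → ∀ {C} → C ∈ S → C ≢ ⊤ → ∃ (C ⋖_)
  parent-exists ⊤∈S {C} C∈S C≢⊤ =
    let (H , (H∈S , C≺H) , H-min) = ∃-minimal (λ H → (H ∈? S) ×-dec (C ≺? H)) (⊤∈S , ⊤-max C , C≢⊤)
    in H , C∈S , H∈S , C≺H , λ (K , K∈S , C≺K , (K≼H , K≢H)) → K≢H (H-min (K∈S , C≺K) K≼H)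

  parents-≼⇒≡ : ∀ {C H₁ H₂} → C ⋖ H₁ → C ⋖ H₂ → H₁ ≼ H₂ → H₁ ≡ H₂
  parents-≼⇒≡ {C} {H₁} {H₂} (_ , H₁∈S , C≺H₁ , _) (_ , _ , _ , nothing-between) H₁≼H₂ with H₁ ≟ H₂
  ... | yes H₁≡H₂ = H₁≡H₂
  ... | no H₁≢H₂  = contradiction (H₁ , H₁∈S , C≺H₁ , (H₁≼H₂ , H₁≢H₂)) nothing-between

  parent-unique : ∀ {C H₁ H₂} → C ⋖ H₁ → C ⋖ H₂ → H₁ ≡ H₂
  parent-unique C⋖H₁@(C∈S , H₁∈S , (C≼H₁ , _) , _) C⋖H₂@(_ , H₂∈S , (C≼H₂ , _) , _)
    with nested-comparable C∈S H₁∈S H₂∈S C≼H₁ C≼H₂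
  ... | inj₁ H₁≼H₂ = parents-≼⇒≡ C⋖H₁ C⋖H₂ H₁≼H₂
  ... | inj₂ H₂≼H₁ = sym (parents-≼⇒≡ C⋖H₂ C⋖H₁ H₂≼H₁)

  ∑-parents : ⊤ ∈ S → ∀ C → ∑⟨ (C ⋖?_) ⟩ const (ρ C) ≡ restrict (_∈? (S - ⊤)) ρ C
  ∑-parents ⊤∈S C with C ∈? (S - ⊤)
  ... | yes C∈S-⊤ =
    let (H , C⋖H) = parent-exists ⊤∈S (p─q⊆p S ⁅ ⊤ ⁆ C∈S-⊤) (x∈p-y⇒x≢y C∈S-⊤)
    in ∑⟨⟩-singleton (C ⋖?_) C⋖H (λ C⋖K → parent-unique C⋖K C⋖H)
  ... | no C∉S-⊤ = ∑⟨⟩-empty (C ⋖?_) λ H (C∈S , _ , C≺H , _) → C∉S-⊤ (x∈p∧x≢y⇒x∈p-y C∈S (≺⇒≢⊤ C≺H))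

  ∑-ρ∘τ : ⊤ ∈ S → ∑⟨ _∈? S ⟩ (ρ ∘ τ L S) ≡ ∑⟨ _∈? (S - ⊤) ⟩ ρ
  ∑-ρ∘τ ⊤∈S = begin
    ∑⟨ _∈? S ⟩ (ρ ∘ τ L S)                ≡⟨ sum-cong-≗ ∑-children ⟩
    ∑[ H < n ] (∑⟨ (_⋖? H) ⟩ ρ)           ≡⟨ ∑-comm (λ H C → restrict (_⋖? H) ρ C) ⟩
    ∑[ C < n ] (∑⟨ (C ⋖?_) ⟩ const (ρ C)) ≡⟨ sum-cong-≗ (∑-parents ⊤∈S) ⟩
    ∑⟨ _∈? (S - ⊤) ⟩ ρ                    ∎
    where
    open ≡-Reasoning
    ∑-children : ∀ H → restrict (_∈? S) (ρ ∘ τ L S) H ≡ ∑⟨ (_⋖? H) ⟩ ρ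
    ∑-children H = case H ∈? S of λ where
      (yes H∈S) → trans (restrict-∈ (_∈? S) (ρ ∘ τ L S) H∈S) (ρ-τ H∈S)
      (no H∉S)  → trans (restrict-∉ (_∈? S) (ρ ∘ τ L S) H∉S)
                        (sym (∑⟨⟩-empty (_⋖? H) λ _ (_ , H∈S , _) → H∉S H∈S))

  ∑-rank-gaps : ⊤ ∈ S → ∑⟨ _∈? S ⟩ (λ H → rkInt L (τ L S H) H) ≡ ρ ⊤
  ∑-rank-gaps ⊤∈S = +-cancelʳ-≡ (∑⟨ _∈? (S - ⊤) ⟩ ρ) _ _ (begin
    ∑⟨ _∈? S ⟩ gap + ∑⟨ _∈? (S - ⊤) ⟩ ρ       ≡⟨ cong (∑⟨ _∈? S ⟩ gap +_) (∑-ρ∘τ ⊤∈S) ⟨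
    ∑⟨ _∈? S ⟩ gap + ∑⟨ _∈? S ⟩ (ρ ∘ τ L S)   ≡⟨ ∑⟨⟩-distrib-+ (_∈? S) gap (ρ ∘ τ L S) ⟨
    ∑⟨ _∈? S ⟩ (λ H → gap H + ρ (τ L S H))    ≡⟨ ∑⟨⟩-cong (_∈? S) (_∈? S) id id gap+ρτ≡ρ ⟩
    ∑⟨ _∈? S ⟩ ρ                              ≡⟨ ∑⟨∈⟩-remove ⊤∈S ⟩
    ρ ⊤ + ∑⟨ _∈? (S - ⊤) ⟩ ρ                  ∎)
    where
    open ≡-Reasoning
    gap : Fin n → ℕ
    gap H = rkInt L (τ L S H) H

    gap+ρτ≡ρ : ∀ {H} → H ∈ S → gap H + ρ (τ L S H) ≡ ρ H
    gap+ρτ≡ρ {H} _ = m∸n+n≡m (ρ-mono (τ≼ H))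

mainTheorem7 : ∀ {n : ℕ} (L : GeomLattice n) (G S : Subset n)
    → IsBuildingSet L G → GeomLattice.⊤ L ∈ G
    → IsNested L G S → GeomLattice.⊤ L ∈ S
    → sumOver L S (λ g → rkInt L (τ L S g) g) ≡ rkL L
mainTheorem7 L G S building _ nested ⊤∈S =
  trans (sumOver≡∑⟨∈⟩ L S _) (NestedSetProperties.∑-rank-gaps L G S building nested ⊤∈S)
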